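{- Let $\mathbf{L}\in\{\mathbf{K},\mathbf{T},\mathbf{K4},\mathbf{S4}\}$. Then (1) $\mathbf{L}^{Krom}$ is weakly less expressive than $\mathbf{L}^{Bool}$, and (2) $\mathbf{L}^{Core}$ is weakly less expressive than $\mathbf{L}^{Horn}$.
   Context: Fix a countable set $\mathcal P$ of propositional letters. Modal formulas are generated by $\varphi ::= \top \mid p \mid \neg\varphi \mid \varphi\vee\varphi \mid \Diamond\varphi \mid \Box\varphi$ with $p\in\mathcal P$; $\wedge,\rightarrow$ are abbreviations and $\bot:=\neg\top$. A Kripke model is $M=(W,R,V)$ with $W\neq\emptyset$, $R\subseteq W\times W$, $V:W\to 2^{\mathcal P}$, with the standard satisfaction relation. The logics $\mathbf{K},\mathbf{T},\mathbf{K4},\mathbf{S4}$ are interpreted over, respectively, all frames, reflexive frames, transitive frames, reflexive and transitive frames. Positive literals: $\lambda ::= \top \mid p \mid \Diamond\lambda \mid \Box\lambda$. A clause is $\Box^s(\neg\lambda_1\vee\dots\vee\neg\lambda_n\vee\lambda_{n+1}\vee\dots\vee\lambda_{n+m})$ with $s,n,m\ge 0$ and $\lambda_i$ positive literals; a clausal-form formula is a finite conjunction of clauses (literals $\lambda,\neg\lambda$ count as clauses). $\mathbf{L}^{Bool}$ is the full modal language over the frame class of $\mathbf{L}$; $\mathbf{L}^{Horn}$: clausal-form formulas all of whose clauses have $m\le1$; $\mathbf{L}^{Krom}$: all clauses have $n+m\le 2$; $\mathbf{L}^{Core}$: both restrictions. For two such languages $\mathcal L_1,\mathcal L_2$ over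 the same frame class $\mathcal C$, a model-preserving translation from $\mathcal L_1$ to $\mathcal L_2$ is an effective map sending each $\mathcal L_1$-formula $\varphi$ to an $\mathcal L_2$-formula $\varphi'$ over the same propositional letters such that for every model $M$ over a frame in $\mathcal C$ and every world $w$, $M,w\models\varphi$ iff $M,w\models\varphi'$. $\mathcal L_1$ is weakly less expressive than $\mathcal L_2$ if there is a model-preserving translation from $\mathcal L_1$ to $\mathcal L_2$ but none from $\mathcal L_2$ to $\mathcal L_1$. -}

module Defs where

open import Data.Nat using (ℕ; zero; suc)
open import Data.List using (List; []; _∷_)
open import Data.List.Relation.Unary.All using (All)
open import Data.Product using (Σ; _×_; _,_; ∃)
open import Data.Sum using (_⊎_)
open import Data.Unit using (⊤)
open import Data.Empty using (⊥)
open import Relation.Nullary using (¬_)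
open import Data.Nat using (_≤_; _+_)
open import Function.Bundles using (_⇔_)
open import Level using (0ℓ)

Letter : Set
Letter = ℕ

data Fml : Set where
  top  : Fml
  var  : Letter → Fml
  neg  : Fml → Fml
  _or_ : Fml → Fml → Fml
  dia  : Fml → Fml
  box  : Fml → Fml

bot : Fml
bot = neg top

_and_ : Fml → Fml → Fml
φ and ψ = neg (neg φ or neg ψ)

record Model : Set₁ where
  field
    W : Set
    R : W → W → Set
    V : W → Letter → Set

open Model public

_,_⊨_ : (M : Model) → W M → Fml → Set
M , w ⊨ top     = ⊤
M , w ⊨ var p   = V M w p
M , w ⊨ neg φ   = ¬ (M , w ⊨ φ)
M , w ⊨ (φ or ψ) = (M , w ⊨ φ) ⊎ (M , w ⊨ ψ)
M , w ⊨ dia φ   = Σ (W M) λ v → R M w v × (M , v ⊨ φ)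
M , w ⊨ box φ   = (v : W M) → R M w v → M , v ⊨ φ

data Logic : Set where
  K T K4 S4 : Logic

Reflexive : Model → Set
Reflexive M = (w : W M) → R M w w

Transitive : Model → Set
Transitive M = (u v w : W M) → R M u v → R M v w → R M u w

InClass : Logic → Model → Set
InClass K  M = ⊤
InClass T  M = Reflexive M
InClass K4 M = Transitive M
InClass S4 M = Reflexive M × Transitive M

data PosLit : Set where
  ltop : PosLit
  lvar : Letter → PosLit
  ldia : PosLit → PosLit
  lbox : PosLit → PosLit

-- a clause  □^s (¬λ₁ ∨ … ∨ ¬λₙ ∨ λₙ₊₁ ∨ … ∨ λₙ₊ₘ)
record Clause : Set where
  constructor clause
  field
    depth : ℕ
    negs  : List PosLit
    poss  : List PosLit

open Clause public

ClausalForm : Set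
ClausalForm = List Clause

len : {A : Set} → List A → ℕ
len []       = 0
len (_ ∷ xs) = suc (len xs)

IsHornClause : Clause → Set
IsHornClause c = len (poss c) ≤ 1

IsKromClause : Clause → Set
IsKromClause c = len (negs c) + len (poss c) ≤ 2

IsCoreClause : Clause → Set
IsCoreClause c = IsHornClause c × IsKromClause c

litF : PosLit → Fml
litF ltop     = top
litF (lvar p) = var p
litF (ldia l) = dia (litF l)
litF (lbox l) = box (litF l)

boxes : ℕ → Fml → Fml
boxes zero    φ = φ
boxes (suc s) φ = box (boxes s φ)

bigOr : List Fml → Fml
bigOr []       = bot
bigOr (φ ∷ []) = φ
bigOr (φ ∷ φs) = φ or bigOr φs

negLits : List PosLit → List Fml
negLits []       = []
negLits (l ∷ ls) = neg (litF l) ∷ negLits ls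

posLits : List PosLit → List Fml
posLits []       = []
posLits (l ∷ ls) = litF l ∷ posLits ls

appendF : List Fml → List Fml → List Fml
appendF []       ys = ys
appendF (x ∷ xs) ys = x ∷ appendF xs ys

clauseF : Clause → Fml
clauseF c = boxes (depth c) (bigOr (appendF (negLits (negs c)) (posLits (poss c))))

cformF : ClausalForm → Fml
cformF []       = top
cformF (c ∷ []) = clauseF c
cformF (c ∷ cs) = clauseF c and cformF cs

record Language : Set₁ where
  field
    Form : Set
    ⟦_⟧  : Form → Fml

open Language public

BoolL : Language
BoolL = record { Form = Fml ; ⟦_⟧ = λ φ → φ }

fragment : (Clause → Set) → Language
fragment P = record
  { Form = Σ ClausalForm (All P)
  ; ⟦_⟧  = λ { (cs , _) → cformF cs } }

HornL KromL CoreL : Language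
HornL = fragment IsHornClause
KromL = fragment IsKromClause
CoreL = fragment IsCoreClause

-- A model-preserving translation from L₁ to L₂ over the frame class of
-- the logic L (an Agda function is a computable, i.e. effective, map).
Translation : Logic → Language → Language → Set₁
Translation L L₁ L₂ =
  Σ (Form L₁ → Form L₂) λ tr →
    (M : Model) → InClass L M → (w : W M) → (φ : Form L₁) →
      (M , w ⊨ (⟦ L₁ ⟧ φ)) ⇔ (M , w ⊨ (⟦ L₂ ⟧ (tr φ)))

WeaklyLessExpressive : Logic → Language → Language → Set₁
WeaklyLessExpressive L L₁ L₂ = Translation L L₁ L₂ × ¬ Translation L L₂ L₁

-- On a one-point reflexive model, which lies in every frame class considered, ◇ and □ are the
-- identity, so a modal formula there is a Boolean formula in the valuation. Sets of valuations
-- defined by Krom clauses are closed under the pointwise majority of three valuations (the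
-- classical polymorphism of 2-CNF), and a model-preserving translation would carry this closure
-- property back to its source formula. But p₀ ∨ p₁ ∨ p₂ and the Horn clause p₀ ∧ p₁ → p₂ are not
-- closed under majority, so neither Bool nor Horn translates into Krom (hence not into Core).
-- The translations in the other direction are inclusions of syntax.
module Submission where

open import Defs
open import Data.Bool using (Bool; true; false; not; _∧_; _∨_) renaming (T to True)
open import Data.Bool.Properties using (not-involutive; T-∧; T-∨)
open import Data.List using ([]; _∷_)
open import Data.List.Relation.Unary.All as All using (All; []; _∷_)
open import Data.Nat using (zero; suc; _+_; _≤_; s≤s; z≤n; _≡ᵇ_; _<ᵇ_)
open import Data.Product using (_×_; _,_; proj₁; proj₂)
open import Data.Sum using (_⊎_; inj₁; inj₂)
import Data.Sum as Sum
open import Data.Sum.Function.Propositional using (_⊎-⇔_)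
open import Data.Unit using (⊤; tt)
open import Function.Base using (_∘_; const)
open import Function.Bundles using (_⇔_; mk⇔; Equivalence)
open import Function.Construct.Identity using (⇔-id)
open import Function.Properties.Equivalence using () renaming (sym to ⇔-sym; trans to ⇔-trans)
open import Function.Related.TypeIsomorphisms using (¬-cong-⇔)
open import Relation.Binary.PropositionalEquality using (_≡_; refl; sym; trans; cong; cong₂; subst)
open import Relation.Nullary using (¬_)

open Equivalence using (to; from)

Valuation : Set
Valuation = Letter → Bool

pointModel : Valuation → Model
pointModel v = record { W = ⊤ ; R = λ _ _ → ⊤ ; V = λ _ p → True (v p) }

pointModel-inClass : ∀ L v → InClass L (pointModel v)
pointModel-inClass K  v = tt
pointModel-inClass T  v = λ _ → tt
pointModel-inClass K4 v = λ _ _ _ _ _ → tt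
pointModel-inClass S4 v = (λ _ → tt) , (λ _ _ _ _ _ → tt)

eval : Valuation → Fml → Bool
eval v top      = true
eval v (var p)  = v p
eval v (neg φ)  = not (eval v φ)
eval v (φ or ψ) = eval v φ ∨ eval v ψ
eval v (dia φ)  = eval v φ
eval v (box φ)  = eval v φ

¬True⇔True-not : ∀ b → (¬ True b) ⇔ True (not b)
¬True⇔True-not true  = mk⇔ (λ ¬t → ¬t tt) (λ ())
¬True⇔True-not false = mk⇔ (const tt) (const λ ())

pointModel⊨⇔eval : ∀ v φ → (pointModel v , tt ⊨ φ) ⇔ True (eval v φ)
pointModel⊨⇔eval v top      = ⇔-id _
pointModel⊨⇔eval v (var p)  = ⇔-id _
pointModel⊨⇔eval v (neg φ)  =
  ⇔-trans (¬-cong-⇔ (pointModel⊨⇔eval v φ)) (¬True⇔True-not (eval v φ))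
pointModel⊨⇔eval v (φ or ψ) =
  ⇔-trans (pointModel⊨⇔eval v φ ⊎-⇔ pointModel⊨⇔eval v ψ) (⇔-sym T-∨)
pointModel⊨⇔eval v (dia φ)  =
  ⇔-trans (mk⇔ (λ (_ , _ , sat) → sat) (λ sat → tt , tt , sat)) (pointModel⊨⇔eval v φ)
pointModel⊨⇔eval v (box φ)  =
  ⇔-trans (mk⇔ (λ sat → sat tt tt) (λ sat _ _ → sat)) (pointModel⊨⇔eval v φ)

translation-preserves-eval : ∀ {L} L₁ L₂ ((tr , _) : Translation L L₁ L₂) (φ : Form L₁) v →
  True (eval v (⟦ L₁ ⟧ φ)) ⇔ True (eval v (⟦ L₂ ⟧ (tr φ)))
translation-preserves-eval {L} L₁ L₂ (tr , preserves) φ v =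
  ⇔-trans (⇔-sym (pointModel⊨⇔eval v (⟦ L₁ ⟧ φ)))
    (⇔-trans (preserves (pointModel v) (pointModel-inClass L v) tt φ)
             (pointModel⊨⇔eval v (⟦ L₂ ⟧ (tr φ))))

maj : Bool → Bool → Bool → Bool
maj true  b c = b ∨ c
maj false b c = b ∧ c

not-maj : ∀ a b c → not (maj a b c) ≡ maj (not a) (not b) (not c)
not-maj true  true  c = refl
not-maj true  false c = refl
not-maj false true  c = refl
not-maj false false c = refl

maj-ab : ∀ {a b} c → True a → True b → True (maj a b c)
maj-ab {true} {true} _ _ _ = tt

maj-ac : ∀ {a} b {c} → True a → True c → True (maj a b c)
maj-ac {true} b _ tc = from (T-∨ {b}) (inj₂ tc)

maj-bc : ∀ a {b c} → True b → True c → True (maj a b c)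
maj-bc true  tb _  = from T-∨ (inj₁ tb)
maj-bc false tb tc = from T-∧ (tb , tc)

-- Of the three disjunctions, two take the same side.
maj-⊎ : ∀ {a b c a′ b′ c′} → True a ⊎ True a′ → True b ⊎ True b′ → True c ⊎ True c′ →
  True (maj a b c) ⊎ True (maj a′ b′ c′)
maj-⊎ {a} {b} {c} {a′} {b′} {c′} = λ where
  (inj₁ ta) (inj₁ tb) _         → inj₁ (maj-ab c ta tb)
  (inj₁ ta) (inj₂ _)  (inj₁ tc) → inj₁ (maj-ac b ta tc)
  (inj₁ _)  (inj₂ tb) (inj₂ tc) → inj₂ (maj-bc a′ tb tc)
  (inj₂ _)  (inj₁ tb) (inj₁ tc) → inj₁ (maj-bc a tb tc)
  (inj₂ ta) (inj₁ _)  (inj₂ tc) → inj₂ (maj-ac b′ ta tc)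
  (inj₂ ta) (inj₂ tb) _         → inj₂ (maj-ab c′ ta tb)

majority : Valuation → Valuation → Valuation → Valuation
majority f g h p = maj (f p) (g p) (h p)

MajorityClosed : Fml → Set
MajorityClosed φ = ∀ f g h → True (eval f φ) → True (eval g φ) → True (eval h φ) →
  True (eval (majority f g h) φ)

CommutesWithMajority : Fml → Set
CommutesWithMajority φ = ∀ f g h →
  eval (majority f g h) φ ≡ maj (eval f φ) (eval g φ) (eval h φ)

litF-commutes : ∀ l → CommutesWithMajority (litF l)
litF-commutes ltop     f g h = refl
litF-commutes (lvar p) f g h = refl
litF-commutes (ldia l) = litF-commutes l
litF-commutes (lbox l) = litF-commutes l

neg-commutes : ∀ φ → CommutesWithMajority φ → CommutesWithMajority (neg φ)
neg-commutes φ commutes f g h =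
  trans (cong not (commutes f g h)) (not-maj (eval f φ) (eval g φ) (eval h φ))

commutes⇒closed : ∀ φ → CommutesWithMajority φ → MajorityClosed φ
commutes⇒closed φ commutes f g h tf tg _ =
  subst True (sym (commutes f g h)) (maj-ab (eval h φ) tf tg)

or-closed : ∀ φ ψ → CommutesWithMajority φ → CommutesWithMajority ψ → MajorityClosed (φ or ψ)
or-closed φ ψ φ-commutes ψ-commutes f g h tf tg th =
  from (T-∨ {eval (majority f g h) φ})
    (Sum.map (subst True (sym (φ-commutes f g h))) (subst True (sym (ψ-commutes f g h)))
             (maj-⊎ (split f tf) (split g tg) (split h th)))
  where
  split : ∀ v → True (eval v (φ or ψ)) → True (eval v φ) ⊎ True (eval v ψ)
  split v = to (T-∨ {eval v φ})

not-∨-not : ∀ a b → not (not a ∨ not b) ≡ a ∧ b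
not-∨-not true  b = not-involutive b
not-∨-not false b = refl

and-closed : ∀ φ ψ → MajorityClosed φ → MajorityClosed ψ → MajorityClosed (φ and ψ)
and-closed φ ψ φ-closed ψ-closed f g h tf tg th =
  subst True (sym (not-∨-not (eval m φ) (eval m ψ)))
    (from T-∧ (φ-closed f g h (proj₁ (split f tf)) (proj₁ (split g tg)) (proj₁ (split h th)) ,
               ψ-closed f g h (proj₂ (split f tf)) (proj₂ (split g tg)) (proj₂ (split h th))))
  where
  m = majority f g h
  split : ∀ v → True (eval v (φ and ψ)) → True (eval v φ) × True (eval v ψ)
  split v = to T-∧ ∘ subst True (not-∨-not (eval v φ) (eval v ψ))

boxes-closed : ∀ s {φ} → MajorityClosed φ → MajorityClosed (boxes s φ)
boxes-closed zero    closed = closed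
boxes-closed (suc s) closed = boxes-closed s closed

bigOr-closed : ∀ φs → All CommutesWithMajority φs → len φs ≤ 2 → MajorityClosed (bigOr φs)
bigOr-closed []              _              _ f g h ()
bigOr-closed (φ ∷ [])        (cφ ∷ [])      _ = commutes⇒closed φ cφ
bigOr-closed (φ ∷ ψ ∷ [])    (cφ ∷ cψ ∷ []) _ = or-closed φ ψ cφ cψ
bigOr-closed (_ ∷ _ ∷ _ ∷ _) _ (s≤s (s≤s ()))

len-appendF : ∀ xs ys → len (appendF xs ys) ≡ len xs + len ys
len-appendF []       ys = refl
len-appendF (x ∷ xs) ys = cong suc (len-appendF xs ys)

len-negLits : ∀ ls → len (negLits ls) ≡ len ls
len-negLits []       = refl
len-negLits (l ∷ ls) = cong suc (len-negLits ls)

len-posLits : ∀ ls → len (posLits ls) ≡ len ls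
len-posLits []       = refl
len-posLits (l ∷ ls) = cong suc (len-posLits ls)

All-appendF : ∀ {P : Fml → Set} {xs ys} → All P xs → All P ys → All P (appendF xs ys)
All-appendF []         pys = pys
All-appendF (px ∷ pxs) pys = px ∷ All-appendF pxs pys

negLits-commute : ∀ ls → All CommutesWithMajority (negLits ls)
negLits-commute []       = []
negLits-commute (l ∷ ls) = neg-commutes (litF l) (litF-commutes l) ∷ negLits-commute ls

posLits-commute : ∀ ls → All CommutesWithMajority (posLits ls)
posLits-commute []       = []
posLits-commute (l ∷ ls) = litF-commutes l ∷ posLits-commute ls

kromClause-closed : ∀ {c} → IsKromClause c → MajorityClosed (clauseF c)
kromClause-closed {clause s ns ps} krom =
  boxes-closed s (bigOr-closed lits
    (All-appendF (negLits-commute ns) (posLits-commute ps))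
    (subst (_≤ 2) (sym len-lits) krom))
  where
  lits = appendF (negLits ns) (posLits ps)
  len-lits : len lits ≡ len ns + len ps
  len-lits = trans (len-appendF (negLits ns) (posLits ps))
                   (cong₂ _+_ (len-negLits ns) (len-posLits ps))

cformF-closed : ∀ cs → All (MajorityClosed ∘ clauseF) cs → MajorityClosed (cformF cs)
cformF-closed []            _                  f g h _ _ _ = tt
cformF-closed (c ∷ [])      (closed ∷ [])      = closed
cformF-closed (c ∷ c′ ∷ cs) (closed ∷ closeds) =
  and-closed (clauseF c) (cformF (c′ ∷ cs)) closed (cformF-closed (c′ ∷ cs) closeds)

KromL-closed : ∀ φ → MajorityClosed (⟦ KromL ⟧ φ)
KromL-closed (cs , kroms) = cformF-closed cs (All.map (λ {c} → kromClause-closed {c}) kroms)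

CoreL-closed : ∀ φ → MajorityClosed (⟦ CoreL ⟧ φ)
CoreL-closed (cs , cores) = KromL-closed (cs , All.map proj₂ cores)

no-translation-into-closed : ∀ {L} L₁ L₂ → (∀ ψ → MajorityClosed (⟦ L₂ ⟧ ψ)) →
  (φ : Form L₁) → ¬ MajorityClosed (⟦ L₁ ⟧ φ) → ¬ Translation L L₁ L₂
no-translation-into-closed L₁ L₂ L₂-closed φ φ-not-closed translation@(tr , _) =
  φ-not-closed λ f g h tf tg th →
    from (preserves (majority f g h))
      (L₂-closed (tr φ) f g h (to (preserves f) tf) (to (preserves g) tg) (to (preserves h) th))
  where
  preserves = translation-preserves-eval L₁ L₂ translation φ

translation-of-same-meaning : ∀ {L} L₁ L₂ (tr : Form L₁ → Form L₂) →
  (∀ φ → ⟦ L₂ ⟧ (tr φ) ≡ ⟦ L₁ ⟧ φ) → Translation L L₁ L₂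
translation-of-same-meaning L₁ L₂ tr same =
  tr , λ M _ w φ → mk⇔ (subst (M , w ⊨_) (sym (same φ))) (subst (M , w ⊨_) (same φ))

only : Letter → Valuation
only p q = q ≡ᵇ p

ternary-or : Form BoolL
ternary-or = var 0 or (var 1 or var 2)

ternary-or-not-closed : ¬ MajorityClosed ternary-or
ternary-or-not-closed closed = closed (only 0) (only 1) (only 2) tt tt tt

horn-implication : Form HornL
horn-implication = (clause 0 (lvar 0 ∷ lvar 1 ∷ []) (lvar 2 ∷ []) ∷ []) , (s≤s z≤n ∷ [])

horn-implication-not-closed : ¬ MajorityClosed (⟦ HornL ⟧ horn-implication)
horn-implication-not-closed closed = closed (only 0) (only 1) (_<ᵇ 3) tt tt tt

theorem3p3 : (L : Logic) →
    WeaklyLessExpressive L KromL BoolL × WeaklyLessExpressive L CoreL HornL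
theorem3p3 L =
  ( translation-of-same-meaning KromL BoolL (cformF ∘ proj₁) (λ _ → refl)
  , no-translation-into-closed BoolL KromL KromL-closed ternary-or ternary-or-not-closed )
  , ( translation-of-same-meaning CoreL HornL (λ (cs , cores) → cs , All.map proj₁ cores)
        (λ _ → refl)
    , no-translation-into-closed HornL CoreL CoreL-closed
        horn-implication horn-implication-not-closed )
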